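{- Let $n\ge 1$ and let $B_n$ be the set of standard domino tableaux with $n$ dominoes whose shape has at most two rows. For $T\in B_n$ let $S_T\subseteq[n]=\{1,\dots,n\}$ be the set of labels of the dominoes that lie horizontally in the first row of $T$. Then the map $T\mapsto S_T$ is a bijection from $B_n$ to the set of all subsets of $[n]$; in particular each $T\in B_n$ is uniquely determined by the set of labels of dominoes lying horizontally in its first row. Consequently, for each $0\le k\le n$ there are exactly $\binom{n}{k}$ elements of $B_n$ having exactly $k$ dominoes lying horizontally in the first row.
   Context: A partition $\lambda=(\lambda_1\ge\lambda_2\ge\dots)$ of $2n$ determines an upper-left-justified (English convention) Young diagram with $\lambda_i$ boxes in row $i$. A domino diagram of shape $\lambda\vdash 2n$ is a tiling of this diagram by $n$ non-overlapping dominoes, each a $1\times 2$ (horizontal) or $2\times 1$ (vertical) rectangle of boxes. A standard domino tableau (SDT) is such a tiling in which the dominoes are labeled bijectively by $1,2,\dots,n$ so that labels increase from left to right along rows and from top to bottom down columns (equivalently, for every $i$, the dominoes labeled $1,\dots,i$ form a Young diagram). The shapes of elements of $B_n$ are $(n+k,n-k)$ with $0\le k\le n$. -}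

module Defs where

open import Data.Nat using (ℕ; zero; suc; _<_)
open import Data.Fin using (Fin; _≤_)
open import Data.Fin.Subset using (Subset)
open import Data.Bool using (Bool; true; false)
open import Data.Vec using (Vec; lookup; tabulate)
open import Data.Product using (Σ; _×_)
open import Data.Sum using (_⊎_)
open import Data.Empty using (⊥)
open import Relation.Binary.PropositionalEquality using (_≡_)
open import Relation.Nullary using (¬_)

-- A placed domino: horiz r c covers cells (r,c),(r,c+1);
-- vert r c covers cells (r,c),(r+1,c).  Rows/columns are 0-indexed,
-- English convention (row 0 is the top row).
data Domino : Set where
  horiz : ℕ → ℕ → Domino
  vert  : ℕ → ℕ → Domino

Covers : Domino → ℕ → ℕ → Set
Covers (horiz r c) r' c' = (r' ≡ r) × ((c' ≡ c) ⊎ (c' ≡ suc c))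
Covers (vert r c)  r' c' = (c' ≡ c) × ((r' ≡ r) ⊎ (r' ≡ suc r))

IsYoung : (ℕ → ℕ → Set) → Set
IsYoung P = ∀ r c r' c' → r' Data.Nat.≤ r → c' Data.Nat.≤ c → P r c → P r' c'

-- A labelled domino diagram: the domino with label i+1 is  lookup T i.
Tableau : ℕ → Set
Tableau n = Vec Domino n

Prefix : ∀ {n} → Tableau n → Fin n → ℕ → ℕ → Set
Prefix {n} T i r c = Σ (Fin n) λ j → (j ≤ i) × Covers (lookup T j) r c

-- Standard domino tableau with n dominoes whose shape has at most two rows:
-- dominoes pairwise non-overlapping, every prefix 1..i forms a Young diagram
-- (so in particular the whole shape is a Young diagram), all cells in rows 0,1.
IsSDT2 : ∀ {n} → Tableau n → Set
IsSDT2 {n} T =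
  (∀ (i j : Fin n) → ¬ (i ≡ j) → ∀ r c →
     Covers (lookup T i) r c → Covers (lookup T j) r c → ⊥)
  × (∀ (i : Fin n) → IsYoung (Prefix T i))
  × (∀ (i : Fin n) r c → Covers (lookup T i) r c → r < 2)

horizFirstRow : Domino → Bool
horizFirstRow (horiz zero c) = true
horizFirstRow (horiz (suc r) c) = false
horizFirstRow (vert r c) = false

S : ∀ {n} → Tableau n → Subset n
S T = tabulate (λ i → horizFirstRow (lookup T i))

-- Reading a tableau label by label, the dominoes placed so far fill a shape with rows of
-- lengths b + 2e and b. A new domino must start exactly at the end of each row it enters,
-- so it is horizontal at the end of the top row, or else vertical in column b when e = 0
-- and horizontal at the end of the bottom row when e > 0 (a vertical domino would overlap
-- the top row, a horizontal one in the bottom row with e = 0 would stick out under it).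
-- So whether label i lies in S_T forces the i-th domino: T is determined by S_T, and
-- placing dominoes by this rule realises every subset. There are n choose k subsets of size k.
module Submission where

open import Defs
open import Data.Bool using (Bool; true; false)
open import Data.Empty using (⊥; ⊥-elim)
open import Data.Fin using (Fin; zero; suc)
import Data.Fin as Fin
open import Data.Fin.Properties using (suc-injective)
open import Data.Fin.Subset using (Subset; ∣_∣)
open import Data.List using (List; []; _∷_; length; map; _++_)
open import Data.List.Membership.Propositional using (_∈_)
open import Data.List.Membership.Propositional.Properties
  using (∈-map⁺; ∈-map⁻; ∈-++⁺ˡ; ∈-++⁺ʳ; ∈-++⁻)
open import Data.List.Properties using (length-map; length-++)
import Data.List.Relation.Unary.All as All
open import Data.List.Relation.Unary.AllPairs using ([]; _∷_)
open import Data.List.Relation.Unary.Any using (here)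
open import Data.List.Relation.Unary.Unique.Propositional using (Unique)
import Data.List.Relation.Unary.Unique.Propositional.Properties as Unique
open import Data.Nat using (ℕ; zero; suc; _≤_; _<_; _+_; z≤n; s≤s)
open import Data.Nat.Combinatorics using (_C_; nCk+nC[k+1]≡[n+1]C[k+1])
open import Data.Nat.Properties
  using (≤-refl; ≤-trans; ≤-<-trans; <-≤-trans; <-trans; <-irrefl; <⇒≤; <⇒≱; <-cmp; n<1+n;
         m≤n⇒m≤1+n; m<n⇒m<1+n; m<1+n⇒m<n∨m≡n)
import Data.Nat.Properties as ℕ
open import Data.Product using (Σ; _×_; _,_; proj₁; proj₂)
import Data.Product as Product
open import Data.Sum using (_⊎_; inj₁; inj₂; [_,_]′; assocˡ; assocʳ)
import Data.Sum as Sum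
open import Data.Vec using (Vec; []; _∷_; lookup)
open import Data.Vec.Properties using (∷-injectiveˡ; ∷-injectiveʳ)
open import Function using (_∘_; id)
open import Function.Bundles using (_⇔_; mk⇔)
open import Relation.Binary.Core using (_⇒_) renaming (_⇔_ to _⇔₂_)
open import Relation.Binary.Construct.Union using (_∪_)
open import Relation.Binary.Definitions using (tri<; tri≈; tri>)
open import Relation.Binary.PropositionalEquality
  using (_≡_; refl; sym; trans; cong; cong₂; subst; module ≡-Reasoning)
open import Relation.Nullary using (¬_)

private
  variable
    P Q R : ℕ → ℕ → Set

m<n∨m≡n⇒m<1+n : ∀ {m n} → m < n ⊎ m ≡ n → m < suc n
m<n∨m≡n⇒m<1+n (inj₁ m<n) = m<n⇒m<1+n m<n
m<n∨m≡n⇒m<1+n (inj₂ refl) = n<1+n _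

m<2+n⇒m<n∨m≡n∨m≡1+n : ∀ {m n} → m < suc (suc n) → m < n ⊎ m ≡ n ⊎ m ≡ suc n
m<2+n⇒m<n∨m≡n∨m≡1+n m<2+n with m<1+n⇒m<n∨m≡n m<2+n
... | inj₁ m<1+n  = Sum.map₂ inj₁ (m<1+n⇒m<n∨m≡n m<1+n)
... | inj₂ m≡1+n = inj₂ (inj₂ m≡1+n)

m<n∨m≡n∨m≡1+n⇒m<2+n : ∀ {m n} → m < n ⊎ m ≡ n ⊎ m ≡ suc n → m < suc (suc n)
m<n∨m≡n∨m≡1+n⇒m<2+n = m<n∨m≡n⇒m<1+n ∘ Sum.map₁ m<n∨m≡n⇒m<1+n ∘ assocˡ

⇔₂-trans : P ⇔₂ Q → Q ⇔₂ R → P ⇔₂ R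
⇔₂-trans (P⇒Q , Q⇒P) (Q⇒R , R⇒Q) = Q⇒R ∘ P⇒Q , Q⇒P ∘ R⇒Q

∪-congˡ : P ⇔₂ Q → R ∪ P ⇔₂ R ∪ Q
∪-congˡ (P⇒Q , Q⇒P) = Sum.map₂ P⇒Q , Sum.map₂ Q⇒P

IsYoung-resp : P ⇔₂ Q → IsYoung P → IsYoung Q
IsYoung-resp (P⇒Q , Q⇒P) young r c r′ c′ r′≤r c′≤c = P⇒Q ∘ young r c r′ c′ r′≤r c′≤c ∘ Q⇒P

column : Domino → ℕ
column (horiz r c) = c
column (vert r c)  = c

column≤ : ∀ d {r c} → Covers d r c → column d ≤ c
column≤ (horiz _ _) (_ , inj₁ refl) = ≤-refl
column≤ (horiz _ _) (_ , inj₂ refl) = m≤n⇒m≤1+n ≤-refl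
column≤ (vert _ _)  (refl , _)      = ≤-refl

-- The two-row shape with rows of lengths bottom + 2 · excess and bottom.
record Shape : Set where
  constructor shape
  field
    bottom excess : ℕ

open Shape

empty : Shape
empty = shape 0 0

topLength : Shape → ℕ
topLength (shape b zero)    = b
topLength (shape b (suc e)) = suc (suc (topLength (shape b e)))

topLength-shift : ∀ b e → topLength (shape (suc (suc b)) e) ≡ suc (suc (topLength (shape b e)))
topLength-shift b zero    = refl
topLength-shift b (suc e) = cong (2 +_) (topLength-shift b e)

bottom≤topLength : ∀ s → bottom s ≤ topLength s
bottom≤topLength (shape b zero)    = ≤-refl
bottom≤topLength (shape b (suc e)) = m≤n⇒m≤1+n (m≤n⇒m≤1+n (bottom≤topLength (shape b e)))

rowLength : Shape → ℕ → ℕ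
rowLength s zero          = topLength s
rowLength s (suc zero)    = bottom s
rowLength s (suc (suc _)) = 0

rowLength-antitone : ∀ s {r r′} → r′ ≤ r → rowLength s r ≤ rowLength s r′
rowLength-antitone s {zero}        z≤n       = ≤-refl
rowLength-antitone s {suc zero}    z≤n       = bottom≤topLength s
rowLength-antitone s {suc zero}    (s≤s z≤n) = ≤-refl
rowLength-antitone s {suc (suc r)} _         = z≤n

Cell : Shape → ℕ → ℕ → Set
Cell s r c = c < rowLength s r

Cell-young : ∀ s → IsYoung (Cell s)
Cell-young s r c r′ c′ r′≤r c′≤c c<ℓ = ≤-<-trans c′≤c (<-≤-trans c<ℓ (rowLength-antitone s r′≤r))

Cell-empty : ∀ r c → ¬ Cell empty r c
Cell-empty zero          c ()
Cell-empty (suc zero)    c ()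
Cell-empty (suc (suc r)) c ()

∪-identityˡ-empty : Cell empty ∪ P ⇔₂ P
∪-identityˡ-empty = (λ {r} {c} → [ ⊥-elim ∘ Cell-empty r c , id ]′) , inj₂

nextDomino : Shape → Bool → Domino
nextDomino s                 true  = horiz 0 (topLength s)
nextDomino (shape b zero)    false = vert 0 b
nextDomino (shape b (suc e)) false = horiz 1 b

grow : Shape → Bool → Shape
grow (shape b e)       true  = shape b (suc e)
grow (shape b zero)    false = shape (suc b) zero
grow (shape b (suc e)) false = shape (suc (suc b)) e

horizFirstRow-nextDomino : ∀ s x → horizFirstRow (nextDomino s x) ≡ x
horizFirstRow-nextDomino s                 true  = refl
horizFirstRow-nextDomino (shape b zero)    false = refl
horizFirstRow-nextDomino (shape b (suc e)) false = refl

nextDomino-twoRows : ∀ s x r c → Covers (nextDomino s x) r c → r < 2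
nextDomino-twoRows s                 true  r c (refl , _)      = s≤s z≤n
nextDomino-twoRows (shape b zero)    false r c (_ , inj₁ refl) = s≤s z≤n
nextDomino-twoRows (shape b zero)    false r c (_ , inj₂ refl) = s≤s (s≤s z≤n)
nextDomino-twoRows (shape b (suc e)) false r c (refl , _)      = s≤s (s≤s z≤n)

nextDomino-outside : ∀ s x r c → Cell s r c → Covers (nextDomino s x) r c → ⊥
nextDomino-outside s x r c c<ℓ covered = <⇒≱ c<ℓ (≤-trans (starts s x r covered) (column≤ _ covered))
  where
  starts : ∀ s x r {c} → Covers (nextDomino s x) r c → rowLength s r ≤ column (nextDomino s x)
  starts s                 true  r (refl , _)      = ≤-refl
  starts (shape b zero)    false r (_ , inj₁ refl) = ≤-refl
  starts (shape b zero)    false r (_ , inj₂ refl) = ≤-refl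
  starts (shape b (suc e)) false r (refl , _)      = ≤-refl

Cell-grow⁻ : ∀ s x → Cell (grow s x) ⇒ Cell s ∪ Covers (nextDomino s x)
Cell-grow⁻ (shape b e)       true  {zero} p = Sum.map₂ (refl ,_) (m<2+n⇒m<n∨m≡n∨m≡1+n p)
Cell-grow⁻ (shape b e)       true  {suc zero} p = inj₁ p
Cell-grow⁻ (shape b zero)    false {zero} p = Sum.map₂ (_, inj₁ refl) (m<1+n⇒m<n∨m≡n p)
Cell-grow⁻ (shape b zero)    false {suc zero} p = Sum.map₂ (_, inj₂ refl) (m<1+n⇒m<n∨m≡n p)
Cell-grow⁻ (shape b (suc e)) false {zero} {c} p = inj₁ (subst (c <_) (topLength-shift b e) p)
Cell-grow⁻ (shape b (suc e)) false {suc zero} p = Sum.map₂ (refl ,_) (m<2+n⇒m<n∨m≡n∨m≡1+n p)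

Cell-grow⁺ : ∀ s x → Cell s ∪ Covers (nextDomino s x) ⇒ Cell (grow s x)
Cell-grow⁺ (shape b e)       true  {zero} h = m<n∨m≡n∨m≡1+n⇒m<2+n (Sum.map₂ proj₂ h)
Cell-grow⁺ (shape b e)       true  {suc zero} (inj₁ p) = p
Cell-grow⁺ (shape b zero)    false {zero} h = m<n∨m≡n⇒m<1+n (Sum.map₂ proj₁ h)
Cell-grow⁺ (shape b zero)    false {suc zero} h = m<n∨m≡n⇒m<1+n (Sum.map₂ proj₁ h)
Cell-grow⁺ (shape b zero)    false {suc (suc r)} (inj₂ (_ , inj₁ ()))
Cell-grow⁺ (shape b zero)    false {suc (suc r)} (inj₂ (_ , inj₂ ()))
Cell-grow⁺ (shape b (suc e)) false {zero} {c} (inj₁ p) = subst (c <_) (sym (topLength-shift b e)) p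
Cell-grow⁺ (shape b (suc e)) false {suc zero} h = m<n∨m≡n∨m≡1+n⇒m<2+n (Sum.map₂ proj₂ h)
Cell-grow⁺ (shape b (suc e)) false {suc (suc r)} (inj₂ (() , _))

Cell-grow : ∀ s x → Cell (grow s x) ⇔₂ Cell s ∪ Covers (nextDomino s x)
Cell-grow s x = Cell-grow⁻ s x , Cell-grow⁺ s x

Cell-grow-∪ : ∀ s x → Cell s ∪ (Covers (nextDomino s x) ∪ P) ⇔₂ Cell (grow s x) ∪ P
Cell-grow-∪ s x = Sum.map₁ (Cell-grow⁺ s x) ∘ assocˡ , assocʳ ∘ Sum.map₁ (Cell-grow⁻ s x)

column≡rowLength : ∀ s d {r} →
  (∀ r c → Cell s r c → Covers d r c → ⊥) → IsYoung (Cell s ∪ Covers d) →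
  Covers d r (column d) → column d ≡ rowLength s r
column≡rowLength s d {r} fresh young covered with <-cmp (column d) (rowLength s r)
... | tri< inside _ _ = ⊥-elim (fresh r _ inside covered)
... | tri≈ _ eq _     = eq
... | tri> _ _ beyond with young r (column d) r (rowLength s r) ≤-refl (<⇒≤ beyond) (inj₂ covered)
...   | inj₁ ℓ<ℓ     = ⊥-elim (<-irrefl refl ℓ<ℓ)
...   | inj₂ covered′ = ⊥-elim (<⇒≱ beyond (column≤ d covered′))

nextDomino-unique : ∀ s d →
  (∀ r c → Cell s r c → Covers d r c → ⊥) → IsYoung (Cell s ∪ Covers d) →
  (∀ r c → Covers d r c → r < 2) → d ≡ nextDomino s (horizFirstRow d)
nextDomino-unique s (horiz zero c) fresh young _ =
  cong (horiz 0) (column≡rowLength s (horiz 0 c) {0} fresh young (refl , inj₁ refl))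
nextDomino-unique s@(shape b zero) (horiz (suc zero) c) fresh young _
  with refl ← column≡rowLength s (horiz 1 c) {1} fresh young (refl , inj₁ refl)
  with young 1 (suc b) 0 (suc b) z≤n ≤-refl (inj₂ (refl , inj₂ refl))
... | inj₁ 1+b<b = ⊥-elim (<-irrefl refl (<-trans (n<1+n b) 1+b<b))
nextDomino-unique s@(shape b (suc e)) (horiz (suc zero) c) fresh young _
  with refl ← column≡rowLength s (horiz 1 c) {1} fresh young (refl , inj₁ refl) = refl
nextDomino-unique s@(shape b zero) (vert zero c) fresh young _
  with refl ← column≡rowLength s (vert 0 c) {1} fresh young (refl , inj₂ refl) = refl
nextDomino-unique s@(shape b (suc e)) (vert zero c) fresh young _
  with refl ← column≡rowLength s (vert 0 c) {1} fresh young (refl , inj₂ refl) =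
  ⊥-elim (fresh 0 b (s≤s (m≤n⇒m≤1+n (bottom≤topLength (shape b e)))) (refl , inj₁ refl))
nextDomino-unique s (horiz (suc (suc r)) c) _ _ twoRows with twoRows _ _ (refl , inj₁ refl)
... | s≤s (s≤s ())
nextDomino-unique s (vert (suc r) c) _ _ twoRows with twoRows _ _ (refl , inj₂ refl)
... | s≤s (s≤s ())

Prefix-zero : ∀ {n} d (T : Tableau n) → Prefix (d ∷ T) zero ⇔₂ Covers d
Prefix-zero d T = to , λ covered → zero , z≤n , covered
  where
  to : Prefix (d ∷ T) zero ⇒ Covers d
  to (zero , _ , covered) = covered

Prefix-suc : ∀ {n} d (T : Tableau n) i → Prefix (d ∷ T) (suc i) ⇔₂ Covers d ∪ Prefix T i
Prefix-suc d T i = to , from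
  where
  to : Prefix (d ∷ T) (suc i) ⇒ Covers d ∪ Prefix T i
  to (zero , _ , covered)          = inj₁ covered
  to (suc j , s≤s j≤i , covered)   = inj₂ (j , j≤i , covered)
  from : Covers d ∪ Prefix T i ⇒ Prefix (d ∷ T) (suc i)
  from (inj₁ covered)              = zero , z≤n , covered
  from (inj₂ (j , j≤i , covered))  = suc j , s≤s j≤i , covered

record IsSkewSDT2 {n} (s : Shape) (T : Tableau n) : Set where
  field
    nonOverlapping : ∀ (i j : Fin n) → ¬ (i ≡ j) → ∀ r c →
                     Covers (lookup T i) r c → Covers (lookup T j) r c → ⊥
    outside        : ∀ (i : Fin n) r c → Cell s r c → Covers (lookup T i) r c → ⊥
    young          : ∀ (i : Fin n) → IsYoung (Cell s ∪ Prefix T i)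
    twoRows        : ∀ (i : Fin n) r c → Covers (lookup T i) r c → r < 2

open IsSkewSDT2

IsSDT2⇒IsSkewSDT2-empty : ∀ {n} {T : Tableau n} → IsSDT2 T → IsSkewSDT2 empty T
IsSDT2⇒IsSkewSDT2-empty (disjoint , prefixYoung , rows) = record
  { nonOverlapping = disjoint
  ; outside        = λ _ r c c∈empty _ → Cell-empty r c c∈empty
  ; young          = λ i → IsYoung-resp (Product.swap ∪-identityˡ-empty) (prefixYoung i)
  ; twoRows        = rows
  }

IsSkewSDT2-empty⇒IsSDT2 : ∀ {n} {T : Tableau n} → IsSkewSDT2 empty T → IsSDT2 T
IsSkewSDT2-empty⇒IsSDT2 V =
  nonOverlapping V ,
  (λ i → IsYoung-resp ∪-identityˡ-empty (young V i)) ,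
  twoRows V

IsSkewSDT2-head : ∀ {n} s d (T : Tableau n) → IsSkewSDT2 s (d ∷ T) → d ≡ nextDomino s (horizFirstRow d)
IsSkewSDT2-head s d T V =
  nextDomino-unique s d (outside V zero) (IsYoung-resp (∪-congˡ (Prefix-zero d T)) (young V zero))
    (twoRows V zero)

IsSkewSDT2-tail : ∀ {n} s x (T : Tableau n) →
  IsSkewSDT2 s (nextDomino s x ∷ T) → IsSkewSDT2 (grow s x) T
IsSkewSDT2-tail s x T V = record
  { nonOverlapping = λ i j i≢j → nonOverlapping V (suc i) (suc j) (i≢j ∘ suc-injective)
  ; outside        = λ i r c c∈grown →
      [ outside V (suc i) r c , nonOverlapping V zero (suc i) (λ ()) r c ]′ (Cell-grow⁻ s x c∈grown)
  ; young          = λ i → IsYoung-resp (⇔₂-trans (∪-congˡ (Prefix-suc _ T i)) (Cell-grow-∪ s x))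
                                        (young V (suc i))
  ; twoRows        = twoRows V ∘ suc
  }

IsSkewSDT2-cons : ∀ {n} s x (T : Tableau n) →
  IsSkewSDT2 (grow s x) T → IsSkewSDT2 s (nextDomino s x ∷ T)
IsSkewSDT2-cons {n} s x T V = record
  { nonOverlapping = disjoint
  ; outside        = outside′
  ; young          = young′
  ; twoRows        = twoRows′
  }
  where
  d : Domino
  d = nextDomino s x
  disjoint : ∀ (i j : Fin (suc n)) → ¬ (i ≡ j) → ∀ r c →
             Covers (lookup (d ∷ T) i) r c → Covers (lookup (d ∷ T) j) r c → ⊥
  disjoint zero    zero    i≢j         = ⊥-elim (i≢j refl)
  disjoint zero    (suc j) _   r c cd    = outside V j r c (Cell-grow⁺ s x (inj₂ cd))
  disjoint (suc i) zero    _   r c ci cd = outside V i r c (Cell-grow⁺ s x (inj₂ cd)) ci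
  disjoint (suc i) (suc j) i≢j         = nonOverlapping V i j (i≢j ∘ cong Fin.suc)
  outside′ : ∀ (i : Fin (suc n)) r c → Cell s r c → Covers (lookup (d ∷ T) i) r c → ⊥
  outside′ zero    = nextDomino-outside s x
  outside′ (suc i) r c c∈s = outside V i r c (Cell-grow⁺ s x {r} {c} (inj₁ c∈s))
  young′ : ∀ (i : Fin (suc n)) → IsYoung (Cell s ∪ Prefix (d ∷ T) i)
  young′ zero    = IsYoung-resp (⇔₂-trans (Cell-grow s x) (∪-congˡ (Product.swap (Prefix-zero d T))))
                                (Cell-young (grow s x))
  young′ (suc i) = IsYoung-resp (⇔₂-trans (Product.swap (Cell-grow-∪ s x))
                                          (∪-congˡ (Product.swap (Prefix-suc d T i))))
                                (young V i)
  twoRows′ : ∀ (i : Fin (suc n)) r c → Covers (lookup (d ∷ T) i) r c → r < 2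
  twoRows′ zero    = nextDomino-twoRows s x
  twoRows′ (suc i) = twoRows V i

fill : ∀ {n} → Shape → Vec Bool n → Tableau n
fill s []       = []
fill s (x ∷ xs) = nextDomino s x ∷ fill (grow s x) xs

fill-IsSkewSDT2 : ∀ {n} s (xs : Vec Bool n) → IsSkewSDT2 s (fill s xs)
fill-IsSkewSDT2 s []       = record { nonOverlapping = λ () ; outside = λ () ; young = λ () ; twoRows = λ () }
fill-IsSkewSDT2 s (x ∷ xs) = IsSkewSDT2-cons s x _ (fill-IsSkewSDT2 (grow s x) xs)

S-fill : ∀ {n} s (xs : Vec Bool n) → S (fill s xs) ≡ xs
S-fill s []       = refl
S-fill s (x ∷ xs) = cong₂ _∷_ (horizFirstRow-nextDomino s x) (S-fill (grow s x) xs)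

IsSkewSDT2⇒≡fill-S : ∀ {n} s (T : Tableau n) → IsSkewSDT2 s T → T ≡ fill s (S T)
IsSkewSDT2⇒≡fill-S s []      _ = refl
IsSkewSDT2⇒≡fill-S s (d ∷ T) V = cong₂ _∷_ d≡next (IsSkewSDT2⇒≡fill-S (grow s x) T tail-valid)
  where
  x : Bool
  x = horizFirstRow d
  d≡next : d ≡ nextDomino s x
  d≡next = IsSkewSDT2-head s d T V
  tail-valid : IsSkewSDT2 (grow s x) T
  tail-valid = IsSkewSDT2-tail s x T (subst (λ d′ → IsSkewSDT2 s (d′ ∷ T)) d≡next V)

subsetsOfSize : (n k : ℕ) → List (Vec Bool n)
subsetsOfSize zero    zero    = [] ∷ []
subsetsOfSize zero    (suc k) = []
subsetsOfSize (suc n) zero    = map (false ∷_) (subsetsOfSize n zero)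
subsetsOfSize (suc n) (suc k) =
  map (true ∷_) (subsetsOfSize n k) ++ map (false ∷_) (subsetsOfSize n (suc k))

length-subsetsOfSize : ∀ n k → length (subsetsOfSize n k) ≡ n C k
length-subsetsOfSize zero    zero    = refl
length-subsetsOfSize zero    (suc k) = refl
length-subsetsOfSize (suc n) zero    =
  trans (length-map _ (subsetsOfSize n zero)) (length-subsetsOfSize n zero)
length-subsetsOfSize (suc n) (suc k) = begin
  length (map (true ∷_) (subsetsOfSize n k) ++ map (false ∷_) (subsetsOfSize n (suc k)))
    ≡⟨ length-++ (map (true ∷_) (subsetsOfSize n k)) ⟩
  length (map (true ∷_) (subsetsOfSize n k)) + length (map (false ∷_) (subsetsOfSize n (suc k)))
    ≡⟨ cong₂ _+_ (length-map _ (subsetsOfSize n k)) (length-map _ (subsetsOfSize n (suc k))) ⟩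
  length (subsetsOfSize n k) + length (subsetsOfSize n (suc k))
    ≡⟨ cong₂ _+_ (length-subsetsOfSize n k) (length-subsetsOfSize n (suc k)) ⟩
  n C k + n C suc k
    ≡⟨ nCk+nC[k+1]≡[n+1]C[k+1] n k ⟩
  suc n C suc k ∎
  where open ≡-Reasoning

subsetsOfSize-unique : ∀ n k → Unique (subsetsOfSize n k)
subsetsOfSize-unique zero    zero    = All.[] ∷ []
subsetsOfSize-unique zero    (suc k) = []
subsetsOfSize-unique (suc n) zero    = Unique.map⁺ ∷-injectiveʳ (subsetsOfSize-unique n zero)
subsetsOfSize-unique (suc n) (suc k) =
  Unique.++⁺ (Unique.map⁺ ∷-injectiveʳ (subsetsOfSize-unique n k))
             (Unique.map⁺ ∷-injectiveʳ (subsetsOfSize-unique n (suc k)))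
             heads-differ
  where
  heads-differ : ∀ {xs} →
    ¬ (xs ∈ map (true ∷_) (subsetsOfSize n k) × xs ∈ map (false ∷_) (subsetsOfSize n (suc k)))
  heads-differ (p , q) with ∈-map⁻ (true ∷_) p | ∈-map⁻ (false ∷_) q
  ... | _ , _ , refl | _ , _ , eq with ∷-injectiveˡ eq
  ... | ()

∈-subsetsOfSize⁻ : ∀ n k {xs : Vec Bool n} → xs ∈ subsetsOfSize n k → ∣ xs ∣ ≡ k
∈-subsetsOfSize⁻ zero    zero    {[]} _ = refl
∈-subsetsOfSize⁻ (suc n) zero    p with ∈-map⁻ (false ∷_) p
... | _ , q , refl = ∈-subsetsOfSize⁻ n zero q
∈-subsetsOfSize⁻ (suc n) (suc k) p with ∈-++⁻ (map (true ∷_) (subsetsOfSize n k)) p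
... | inj₁ p′ with ∈-map⁻ (true ∷_) p′
...   | _ , q , refl = cong suc (∈-subsetsOfSize⁻ n k q)
∈-subsetsOfSize⁻ (suc n) (suc k) p | inj₂ p′ with ∈-map⁻ (false ∷_) p′
...   | _ , q , refl = ∈-subsetsOfSize⁻ n (suc k) q

∈-subsetsOfSize⁺ : ∀ n k (xs : Vec Bool n) → ∣ xs ∣ ≡ k → xs ∈ subsetsOfSize n k
∈-subsetsOfSize⁺ zero    zero    []           _  = here refl
∈-subsetsOfSize⁺ (suc n) zero    (false ∷ xs) eq = ∈-map⁺ (false ∷_) (∈-subsetsOfSize⁺ n zero xs eq)
∈-subsetsOfSize⁺ (suc n) (suc k) (true ∷ xs)  eq =
  ∈-++⁺ˡ (∈-map⁺ (true ∷_) (∈-subsetsOfSize⁺ n k xs (ℕ.suc-injective eq)))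
∈-subsetsOfSize⁺ (suc n) (suc k) (false ∷ xs) eq =
  ∈-++⁺ʳ (map (true ∷_) (subsetsOfSize n k)) (∈-map⁺ (false ∷_) (∈-subsetsOfSize⁺ n (suc k) xs eq))

fill-empty-IsSDT2 : ∀ {n} (X : Subset n) → IsSDT2 (fill empty X)
fill-empty-IsSDT2 X = IsSkewSDT2-empty⇒IsSDT2 (fill-IsSkewSDT2 empty X)

IsSDT2⇒≡fill-S : ∀ {n} (T : Tableau n) → IsSDT2 T → T ≡ fill empty (S T)
IsSDT2⇒≡fill-S T V = IsSkewSDT2⇒≡fill-S empty T (IsSDT2⇒IsSkewSDT2-empty V)

fill-injective : ∀ {n} s {xs ys : Vec Bool n} → fill s xs ≡ fill s ys → xs ≡ ys
fill-injective s {xs} {ys} eq = trans (sym (S-fill s xs)) (trans (cong S eq) (S-fill s ys))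

∈-fill-subsetsOfSize : ∀ n k (T : Tableau n) →
  T ∈ map (fill empty) (subsetsOfSize n k) ⇔ (IsSDT2 T × (∣ S T ∣ ≡ k))
∈-fill-subsetsOfSize n k T = mk⇔ sound complete
  where
  sound : T ∈ map (fill empty) (subsetsOfSize n k) → IsSDT2 T × (∣ S T ∣ ≡ k)
  sound p with ∈-map⁻ (fill empty) p
  ... | X , X∈ , refl = fill-empty-IsSDT2 X , trans (cong ∣_∣ (S-fill empty X)) (∈-subsetsOfSize⁻ n k X∈)
  complete : IsSDT2 T × (∣ S T ∣ ≡ k) → T ∈ map (fill empty) (subsetsOfSize n k)
  complete (V , size) = subst (_∈ map (fill empty) (subsetsOfSize n k)) (sym (IsSDT2⇒≡fill-S T V))
                              (∈-map⁺ (fill empty) (∈-subsetsOfSize⁺ n k (S T) size))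

theorem2p3 : (n : ℕ) → 1 ≤ n →
    ((X : Subset n) → Σ (Tableau n) λ T → IsSDT2 T × (S T ≡ X))
    × (∀ (T T′ : Tableau n) → IsSDT2 T → IsSDT2 T′ → S T ≡ S T′ → T ≡ T′)
    × (∀ (k : ℕ) → k ≤ n →
         Σ (List (Tableau n)) λ L →
           Unique L
           × (∀ (T : Tableau n) → (T ∈ L) ⇔ (IsSDT2 T × (∣ S T ∣ ≡ k)))
           × (length L ≡ n C k))
theorem2p3 n _ = surjective , injective , counting
  where
  surjective : (X : Subset n) → Σ (Tableau n) λ T → IsSDT2 T × (S T ≡ X)
  surjective X = fill empty X , fill-empty-IsSDT2 X , S-fill empty X
  injective : ∀ (T T′ : Tableau n) → IsSDT2 T → IsSDT2 T′ → S T ≡ S T′ → T ≡ T′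
  injective T T′ V V′ eq =
    trans (IsSDT2⇒≡fill-S T V) (trans (cong (fill empty) eq) (sym (IsSDT2⇒≡fill-S T′ V′)))
  counting : ∀ k → k ≤ n → Σ (List (Tableau n)) λ L → Unique L
    × (∀ (T : Tableau n) → (T ∈ L) ⇔ (IsSDT2 T × (∣ S T ∣ ≡ k))) × (length L ≡ n C k)
  counting k _ =
    map (fill empty) (subsetsOfSize n k) ,
    Unique.map⁺ (fill-injective empty) (subsetsOfSize-unique n k) ,
    ∈-fill-subsetsOfSize n k ,
    trans (length-map (fill empty) (subsetsOfSize n k)) (length-subsetsOfSize n k)
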